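{- Let $G=C(m,n;k,l;c,d)$ be a $C$-shaped supergrid graph with $a=m-k=1$ (and $m\geqslant 2$, $n\geqslant 3$, $k,l,c\geqslant 1$, $d=n-l-c\geqslant 1$), and let $s,t$ be two distinct vertices of $G$ such that $(G,s,t)$ satisfies none of the conditions (F1), (F3), (F9) defined below. Then $G$ contains a Hamiltonian path from $s$ to $t$.
   Context: The supergrid graph on a finite set $V\subset\mathbb{Z}^2$ has vertex set $V$, two distinct vertices $u,v$ adjacent iff $|u_x-v_x|\leqslant 1$ and $|u_y-v_y|\leqslant 1$. $R(m,n)$ is the supergrid graph on $\{(x,y):1\leqslant x\leqslant m, 1\leqslant y\leqslant n\}$. $C(m,n;k,l;c,d)$ is the supergrid graph on $V(R(m,n))\setminus\{(x,y): a+1\leqslant x\leqslant m,\ c+1\leqslant y\leqslant c+l\}$, where $a=m-k$, $d=n-l-c$. (F1) $s$ or $t$ is a cut vertex of $G$, or $\{s,t\}$ is a vertex cut of $G$ (i.e. $G-\{s,t\}$ is disconnected). (F3) there is a vertex $w\notin\{s,t\}$ with $\deg(w)=1$. (F9) $a=1$, and ($s_y,t_y\leqslant c$ or $s_y,t_y>c+l$). -}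

module Defs where

open import Data.Nat using (ℕ; suc; _+_; _∸_; _≤_; _<_; ∣_-_∣)
open import Data.Product using (_×_; _,_; proj₁; proj₂; ∃; ∃-syntax)
open import Data.Sum using (_⊎_)
open import Data.List using (List; []; _∷_; _++_; [_])
open import Data.List.Membership.Propositional using (_∈_)
open import Data.List.Relation.Unary.Unique.Propositional using (Unique)
open import Data.List.Relation.Unary.Linked using (Linked)
open import Relation.Nullary using (¬_)
open import Relation.Binary.PropositionalEquality using (_≡_)

-- Vertices are points of ℤ²; all relevant points have positive coordinates,
-- so we use ℕ × ℕ (coordinates x , y).
Pt : Set
Pt = ℕ × ℕ

_ˣ : Pt → ℕ
p ˣ = proj₁ p

_ʸ : Pt → ℕ
p ʸ = proj₂ p

Adj : Pt → Pt → Set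
Adj u v = ¬ (u ≡ v) × ∣ u ˣ - v ˣ ∣ ≤ 1 × ∣ u ʸ - v ʸ ∣ ≤ 1

InR : ℕ → ℕ → Pt → Set
InR m n p = (1 ≤ p ˣ × p ˣ ≤ m) × (1 ≤ p ʸ × p ʸ ≤ n)

InC : (m n k l c : ℕ) → Pt → Set
InC m n k l c p =
  InR m n p × ¬ ((suc (m ∸ k) ≤ p ˣ × p ˣ ≤ m) × (suc c ≤ p ʸ × p ʸ ≤ c + l))

VSet : Set₁
VSet = Pt → Set

Minus : VSet → (Pt → Set) → VSet
Minus W R p = W p × ¬ R p

data Walk (W : VSet) : Pt → Pt → Set where
  here : ∀ {u} → W u → Walk W u u
  step : ∀ {u v w} → W u → Adj u v → Walk W v w → Walk W u w

Disconnected : VSet → Set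
Disconnected W = ∃[ u ] ∃[ v ] (W u × W v × ¬ Walk W u v)

F1 : VSet → Pt → Pt → Set
F1 V s t = Disconnected (Minus V (λ p → p ≡ s))
         ⊎ Disconnected (Minus V (λ p → p ≡ t))
         ⊎ Disconnected (Minus V (λ p → p ≡ s ⊎ p ≡ t))

Deg1 : VSet → Pt → Set
Deg1 V w = ∃[ u ] (V u × Adj w u × (∀ v → V v → Adj w v → v ≡ u))

F3 : VSet → Pt → Pt → Set
F3 V s t = ∃[ w ] (V w × ¬ (w ≡ s) × ¬ (w ≡ t) × Deg1 V w)

F9 : (m k l c : ℕ) → Pt → Pt → Set
F9 m k l c s t = m ∸ k ≡ 1 ×
  ((s ʸ ≤ c × t ʸ ≤ c) ⊎ (c + l < s ʸ × c + l < t ʸ))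

record HamPath (V : VSet) (s t : Pt) : Set where
  field
    path   : List Pt
    start  : ∃[ r ] (path ≡ s ∷ r)
    end    : ∃[ r ] (path ≡ r ++ [ t ])
    linked : Linked Adj path
    unique : Unique path
    sound  : ∀ p → p ∈ path → V p
    cover  : ∀ p → V p → p ∈ path

-- With a = 1 the notch leaves only column 1 beside it, so the C-shape is a bottom rectangle
-- [1,m] × [1,c] and a top rectangle [1,m] × [c+l+1,n] joined by the bridge {1} × [c+1,c+l].
-- Every bridge vertex is a cut vertex (F1), and (F9) forbids s and t on the same side, so s lies in
-- one rectangle and t in the other.  The path runs through the bottom rectangle from s to (1,c) or
-- (2,c), up the bridge, and through the top rectangle from (1,c+l+1) or (2,c+l+1) to t.  In an
-- m × h rectangle with m, h ≥ 2 such a path exists from every vertex (induction on m + h, splitting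
-- off the top row or, after transposing, column 1).  A one-row rectangle (c = 1 or d = 1) needs its
-- endpoint at the far end (m, ·) unless m = 2; otherwise that endpoint is a cut vertex or the far
-- corner has degree 1, which (F1) and (F3) exclude.

module Submission where

open import Defs
open import Data.Nat using (ℕ; zero; suc; _+_; _∸_; _≤_; _<_; z≤n; s≤s; s≤s⁻¹; ∣_-_∣; _≤?_; _≟_)
open import Data.Nat.Properties
open import Data.Product using (_×_; _,_; proj₁; proj₂; ∃-syntax)
open import Data.Sum using (_⊎_; inj₁; inj₂) renaming ([_,_]′ to either)
import Data.Sum as Sum
open import Data.Empty using (⊥-elim)
open import Data.List using (List; []; _∷_; _++_; [_]; reverse; reverseAcc; map)
open import Data.List.Properties using (++-assoc; reverse-++; unfold-reverse; map-++)
open import Data.List.Membership.Propositional using (_∈_)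
open import Data.List.Membership.Propositional.Properties using (∈-++⁺ˡ; ∈-++⁺ʳ; ∈-++⁻; ∈-map⁺; ∈-map⁻)
open import Data.List.Relation.Unary.Any using (here)
import Data.List.Relation.Unary.Any.Properties as Any
open import Data.List.Relation.Unary.All as All using (All; []; _∷_)
open import Data.List.Relation.Unary.Unique.Propositional using (Unique)
open import Data.List.Relation.Unary.AllPairs using ([]; _∷_)
import Data.List.Relation.Unary.Unique.Propositional.Properties as Unique
open import Data.List.Relation.Unary.Linked using (Linked; []; [-]; _∷_)
open import Relation.Binary.PropositionalEquality
  using (_≡_; refl; sym; trans; cong; cong₂; subst; subst₂; setoid; module ≡-Reasoning)
open import Data.List.Relation.Binary.Permutation.Setoid.Properties (setoid Pt) using (Unique-resp-↭; ↭-reverse)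
open import Data.List.Relation.Binary.Permutation.Setoid (setoid Pt) using (↭-sym)
open import Relation.Unary using (_⊆_; _≐_; _∪_; _⊥_)
open import Relation.Nullary using (¬_; yes; no)
open import Function using (_∘_)

open HamPath

Adj-sym : ∀ {u v} → Adj u v → Adj v u
Adj-sym {ux , uy} {vx , vy} (u≢v , dx , dy) =
  u≢v ∘ sym , subst (_≤ 1) (∣-∣-comm ux vx) dx , subst (_≤ 1) (∣-∣-comm uy vy) dy

Linked-++-∷ : ∀ xs {u v ys} → Linked Adj (xs ++ [ u ]) → Adj u v → Linked Adj (v ∷ ys) →
              Linked Adj (xs ++ u ∷ v ∷ ys)
Linked-++-∷ []           _       u~v vys = u~v ∷ vys
Linked-++-∷ (_ ∷ [])     (r ∷ l) u~v vys = r ∷ Linked-++-∷ [] l u~v vys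
Linked-++-∷ (_ ∷ y ∷ xs) (r ∷ l) u~v vys = r ∷ Linked-++-∷ (y ∷ xs) l u~v vys

Linked-reverseAcc : ∀ xs x acc → Linked Adj (x ∷ xs) → Linked Adj (x ∷ acc) →
                    Linked Adj (reverseAcc (x ∷ acc) xs)
Linked-reverseAcc []       _ _   _       acc~ = acc~
Linked-reverseAcc (y ∷ ys) x acc (r ∷ l) acc~ = Linked-reverseAcc ys y (x ∷ acc) l (Adj-sym r ∷ acc~)

Linked-reverse : ∀ {xs} → Linked Adj xs → Linked Adj (reverse xs)
Linked-reverse {[]}     _ = []
Linked-reverse {x ∷ xs} l = Linked-reverseAcc xs x [] l [-]

Unique-reverse : ∀ {xs : List Pt} → Unique xs → Unique (reverse xs)
Unique-reverse {xs} = Unique-resp-↭ (↭-sym (↭-reverse xs))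

HamPath-reverse : ∀ {V s t} → HamPath V s t → HamPath V t s
HamPath-reverse {t = t} P with start P | end P
... | xs , path≡s∷xs | ys , path≡ys∷ʳt = record
  { path   = reverse (path P)
  ; start  = reverse ys , trans (cong reverse path≡ys∷ʳt) (reverse-++ ys [ t ])
  ; end    = reverse xs , trans (cong reverse path≡s∷xs) (unfold-reverse _ xs)
  ; linked = Linked-reverse (linked P)
  ; unique = Unique-reverse (unique P)
  ; sound  = λ p → sound P p ∘ Any.reverse⁻
  ; cover  = λ p → Any.reverse⁺ ∘ cover P p
  }

HamPath-append : ∀ {A B s u v t} → HamPath A s u → HamPath B v t → Adj u v → A ⊥ B →
                 HamPath (A ∪ B) s t
HamPath-append {A} {B} {s} {u} {v} {t} P Q u~v A⊥B = record
  { path   = path P ++ path Q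
  ; start  = proj₁ (start P) ++ path Q , cong (_++ path Q) (proj₂ (start P))
  ; end    = path P ++ proj₁ (end Q) ,
             trans (cong (path P ++_) (proj₂ (end Q))) (sym (++-assoc (path P) (proj₁ (end Q)) [ t ]))
  ; linked = linked-++ (end P) (start Q)
  ; unique = Unique.++⁺ (unique P) (unique Q) (λ (i , j) → A⊥B (sound P _ i , sound Q _ j))
  ; sound  = λ p i → Sum.map (sound P p) (sound Q p) (∈-++⁻ (path P) i)
  ; cover  = λ p → either (∈-++⁺ˡ ∘ cover P p) (∈-++⁺ʳ (path P) ∘ cover Q p)
  }
  where
  linked-++ : ∃[ xs ] (path P ≡ xs ++ [ u ]) → ∃[ ys ] (path Q ≡ v ∷ ys) → Linked Adj (path P ++ path Q)
  linked-++ (xs , refl) (ys , refl) rewrite ++-assoc xs [ u ] (v ∷ ys) =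
    Linked-++-∷ xs (linked P) u~v (linked Q)

HamPath-resp-≐ : ∀ {A B s t} → A ≐ B → HamPath A s t → HamPath B s t
HamPath-resp-≐ (A⊆B , B⊆A) P = record
  { path = path P ; start = start P ; end = end P ; linked = linked P ; unique = unique P
  ; sound = λ p → A⊆B ∘ sound P p ; cover = λ p → cover P p ∘ B⊆A }

HamPath-singleton : ∀ {V} q → V q → (∀ p → V p → p ≡ q) → HamPath V q q
HamPath-singleton q Vq only = record
  { path = [ q ] ; start = [] , refl ; end = [] , refl ; linked = [-] ; unique = [] ∷ []
  ; sound = λ { _ (here refl) → Vq } ; cover = λ p → here ∘ only p }

module _ {V W : VSet} (f : Pt → Pt)
  (f-injective : ∀ p q → V p → V q → f p ≡ f q → p ≡ q)
  (f-Adj : ∀ p q → V p → V q → Adj p q → Adj (f p) (f q))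
  (f-into : ∀ p → V p → W (f p))
  (f-onto : ∀ q → W q → ∃[ p ] (V p × f p ≡ q)) where

  private
    Linked-map : ∀ {xs} → All V xs → Linked Adj xs → Linked Adj (map f xs)
    Linked-map _                   []      = []
    Linked-map _                   [-]     = [-]
    Linked-map (Vx ∷ Vys@(Vy ∷ _)) (r ∷ l) = f-Adj _ _ Vx Vy r ∷ Linked-map Vys l

    Unique-map : ∀ {xs} → All V xs → Unique xs → Unique (map f xs)
    Unique-map []         []         = []
    Unique-map {x ∷ _} (Vx ∷ Vxs) (x∉xs ∷ xs-unique) = distinct Vxs x∉xs ∷ Unique-map Vxs xs-unique
      where
      distinct : ∀ {ys} → All V ys → All (λ y → ¬ x ≡ y) ys → All (λ y → ¬ f x ≡ y) (map f ys)
      distinct []         []         = []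
      distinct (Vy ∷ Vys) (x≢y ∷ ne) = (x≢y ∘ f-injective _ _ Vx Vy) ∷ distinct Vys ne

  HamPath-map : ∀ {s t} → HamPath V s t → HamPath W (f s) (f t)
  HamPath-map {s} {t} P = record
    { path   = map f (path P)
    ; start  = map f (proj₁ (start P)) , cong (map f) (proj₂ (start P))
    ; end    = map f (proj₁ (end P)) ,
               trans (cong (map f) (proj₂ (end P))) (map-++ f (proj₁ (end P)) [ t ])
    ; linked = Linked-map V-path (linked P)
    ; unique = Unique-map V-path (unique P)
    ; sound  = λ q i → let (p , j , q≡fp) = ∈-map⁻ f i in subst W (sym q≡fp) (f-into p (sound P p j))
    ; cover  = λ q Wq → let (p , Vp , fp≡q) = f-onto q Wq in
                         subst (_∈ map f (path P)) fp≡q (∈-map⁺ f (cover P p Vp))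
    }
    where
    V-path : All V (path P)
    V-path = All.tabulate (sound P _)

Rect : ℕ → ℕ → ℕ → ℕ → VSet
Rect x₁ x₂ y₁ y₂ p = (x₁ ≤ p ˣ × p ˣ ≤ x₂) × (y₁ ≤ p ʸ × p ʸ ≤ y₂)

transpose : Pt → Pt
transpose (x , y) = y , x

Adj-transpose : ∀ {u v} → Adj u v → Adj (transpose u) (transpose v)
Adj-transpose (u≢v , dx , dy) = u≢v ∘ cong transpose , dy , dx

HamPath-transpose : ∀ {a b c d s t} → HamPath (Rect a b c d) s t →
                    HamPath (Rect c d a b) (transpose s) (transpose t)
HamPath-transpose = HamPath-map transpose
  (λ _ _ _ _ → cong transpose)
  (λ _ _ _ _ → Adj-transpose)
  (λ _ (x , y) → y , x)
  (λ (x , y) (x' , y') → (y , x) , (y' , x') , refl)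

module _ {a b e c d : ℕ} (a≤1+b : a ≤ suc b) (b≤e : b ≤ e) where

  glueˣ : ∀ {s u v t} → HamPath (Rect a b c d) s u → HamPath (Rect (suc b) e c d) v t → Adj u v →
          HamPath (Rect a e c d) s t
  glueˣ P Q u~v = HamPath-resp-≐ (split , join) (HamPath-append P Q u~v disjoint)
    where
    disjoint : Rect a b c d ⊥ Rect (suc b) e c d
    disjoint (((_ , x≤b) , _) , ((b<x , _) , _)) = <⇒≱ b<x x≤b
    split : Rect a b c d ∪ Rect (suc b) e c d ⊆ Rect a e c d
    split (inj₁ ((a≤x , x≤b) , y)) = (a≤x , ≤-trans x≤b b≤e) , y
    split (inj₂ ((b<x , x≤e) , y)) = (≤-trans a≤1+b b<x , x≤e) , y
    join : Rect a e c d ⊆ Rect a b c d ∪ Rect (suc b) e c d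
    join {p} ((a≤x , x≤e) , y) with p ˣ ≤? b
    ... | yes x≤b = inj₁ ((a≤x , x≤b) , y)
    ... | no  x≰b = inj₂ ((≰⇒> x≰b , x≤e) , y)

  glueʸ : ∀ {s u v t} → HamPath (Rect c d a b) s u → HamPath (Rect c d (suc b) e) v t → Adj u v →
          HamPath (Rect c d a e) s t
  glueʸ P Q u~v = HamPath-transpose (glueˣ (HamPath-transpose P) (HamPath-transpose Q) (Adj-transpose u~v))

data Near : ℕ → ℕ → Set where
  stay : ∀ {x} → Near x x
  inc  : ∀ {x} → Near x (suc x)
  dec  : ∀ {x} → Near (suc x) x

Near⇒∣-∣≤1 : ∀ {x x'} → Near x x' → ∣ x - x' ∣ ≤ 1
Near⇒∣-∣≤1 {x}       stay = ≤-trans (≤-reflexive (∣n-n∣≡0 x)) z≤n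
Near⇒∣-∣≤1 {zero}    inc  = ≤-refl
Near⇒∣-∣≤1 {suc x}   inc  = Near⇒∣-∣≤1 {x} inc
Near⇒∣-∣≤1 {_} {x'}  dec  = subst (_≤ 1) (∣-∣-comm x' (suc x')) (Near⇒∣-∣≤1 {x'} inc)

adj→ : ∀ {x y y'} → Near y y' → Adj (x , y) (suc x , y')
adj→ {x} y~y' = (λ ()) ∘ cong proj₁ , Near⇒∣-∣≤1 {x} inc , Near⇒∣-∣≤1 y~y'

adj↑ : ∀ {x x' y} → Near x x' → Adj (x , y) (x' , suc y)
adj↑ {y = y} x~x' = (λ ()) ∘ cong proj₂ , Near⇒∣-∣≤1 x~x' , Near⇒∣-∣≤1 {y} inc

point : ∀ x y → HamPath (Rect x x y y) (x , y) (x , y)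
point x y = HamPath-singleton (x , y) ((≤-refl , ≤-refl) , (≤-refl , ≤-refl))
  (λ _ ((x≤ , ≤x) , (y≤ , ≤y)) → cong₂ _,_ (≤-antisym ≤x x≤) (≤-antisym ≤y y≤))

row : ∀ {a b} y → a ≤ b → HamPath (Rect a b y y) (a , y) (b , y)
row {a} y a≤b = subst (λ b → HamPath (Rect a b y y) (a , y) (b , y)) (m∸n+n≡m a≤b) (go (_ ∸ a) a)
  where
  go : ∀ n a → HamPath (Rect a (n + a) y y) (a , y) (n + a , y)
  go zero    a = point a y
  go (suc n) a = glueˣ (n≤1+n a) (m≤n+m a (suc n)) (point a y)
    (subst (λ b → HamPath (Rect (suc a) b y y) (suc a , y) (b , y)) (+-suc n a) (go n (suc a)))
    (adj→ stay)

column : ∀ {a b} x → a ≤ b → HamPath (Rect x x a b) (x , a) (x , b)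
column x a≤b = HamPath-transpose (row x a≤b)

shiftˣ : ℕ → Pt → Pt
shiftˣ k (x , y) = k + x , y

HamPath-shiftˣ : ∀ k {a b c d s t} → HamPath (Rect a b c d) s t →
                 HamPath (Rect (k + a) (k + b) c d) (shiftˣ k s) (shiftˣ k t)
HamPath-shiftˣ k {a} {b} {c} {d} = HamPath-map (shiftˣ k) (λ _ _ _ _ → injective)
  (λ (x , _) (x' , _) _ _ (p≢q , dx , dy) →
    p≢q ∘ injective , subst (_≤ 1) (sym (∣m+n-m+o∣≡∣n-o∣ k x x')) dx , dy)
  (λ _ ((a≤x , x≤b) , y) → (+-monoʳ-≤ k a≤x , +-monoʳ-≤ k x≤b) , y)
  onto
  where
  injective : ∀ {p q} → shiftˣ k p ≡ shiftˣ k q → p ≡ q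
  injective {x , y} {x' , y'} e = cong₂ _,_ (+-cancelˡ-≡ k x x' (cong proj₁ e)) (cong proj₂ e)
  onto : ∀ q → Rect (k + a) (k + b) c d q → ∃[ p ] (Rect a b c d p × shiftˣ k p ≡ q)
  onto (x , y) ((k+a≤x , x≤k+b) , y∈) = (x ∸ k , y) ,
    ((subst (_≤ x ∸ k) (m+n∸m≡n k a) (∸-monoˡ-≤ k k+a≤x) ,
      subst (x ∸ k ≤_) (m+n∸m≡n k b) (∸-monoˡ-≤ k x≤k+b)) , y∈) ,
    cong (_, y) (m+[n∸m]≡n (≤-trans (m≤m+n k a) k+a≤x))

∣[k∸x]-[k∸x']∣≡∣x-x'∣ : ∀ k x x' → x ≤ k → x' ≤ k → ∣ (k ∸ x) - (k ∸ x') ∣ ≡ ∣ x - x' ∣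
∣[k∸x]-[k∸x']∣≡∣x-x'∣ k zero x' _ x'≤k =
  trans (∣-∣-comm k (k ∸ x')) (trans (m≤n⇒∣m-n∣≡n∸m (m∸n≤m k x')) (m∸[m∸n]≡n x'≤k))
∣[k∸x]-[k∸x']∣≡∣x-x'∣ k (suc x) zero x≤k _ = trans (m≤n⇒∣m-n∣≡n∸m (m∸n≤m k (suc x))) (m∸[m∸n]≡n x≤k)
∣[k∸x]-[k∸x']∣≡∣x-x'∣ (suc k) (suc x) (suc x') (s≤s x≤k) (s≤s x'≤k) = ∣[k∸x]-[k∸x']∣≡∣x-x'∣ k x x' x≤k x'≤k

reflectˣ : ℕ → Pt → Pt
reflectˣ m (x , y) = suc m ∸ x , y

reflectˣ-involutive : ∀ m p → p ˣ ≤ suc m → reflectˣ m (reflectˣ m p) ≡ p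
reflectˣ-involutive m (x , y) x≤1+m = cong (_, y) (m∸[m∸n]≡n x≤1+m)

reflectˣ-∈ : ∀ m x → 1 ≤ x → x ≤ m → 1 ≤ suc m ∸ x × suc m ∸ x ≤ m
reflectˣ-∈ m x 1≤x x≤m = subst (1 ≤_) (sym (+-∸-assoc 1 x≤m)) (s≤s z≤n) , ∸-monoʳ-≤ (suc m) 1≤x

HamPath-reflectˣ : ∀ m {c d s t} → HamPath (Rect 1 m c d) s t →
                   HamPath (Rect 1 m c d) (reflectˣ m s) (reflectˣ m t)
HamPath-reflectˣ m {c} {d} = HamPath-map (reflectˣ m) injective
  (λ p@(x , _) q@(x' , _) Vp@((_ , x≤m) , _) Vq@((_ , x'≤m) , _) (p≢q , dx , dy) →
    p≢q ∘ injective p q Vp Vq ,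
    subst (_≤ 1) (sym (∣[k∸x]-[k∸x']∣≡∣x-x'∣ (suc m) x x' (m≤n⇒m≤1+n x≤m) (m≤n⇒m≤1+n x'≤m))) dx , dy)
  (λ (x , _) ((1≤x , x≤m) , y) → reflectˣ-∈ m x 1≤x x≤m , y)
  (λ (x , y) ((1≤x , x≤m) , y∈) →
    (suc m ∸ x , y) , (reflectˣ-∈ m x 1≤x x≤m , y∈) , reflectˣ-involutive m (x , y) (m≤n⇒m≤1+n x≤m))
  where
  injective : ∀ p q → Rect 1 m c d p → Rect 1 m c d q → reflectˣ m p ≡ reflectˣ m q → p ≡ q
  injective (x , y) (x' , y') ((_ , x≤m) , _) ((_ , x'≤m) , _) e =
    cong₂ _,_ (∸-cancelˡ-≡ (m≤n⇒m≤1+n x≤m) (m≤n⇒m≤1+n x'≤m) (cong proj₁ e)) (cong proj₂ e)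

TopLeftPath : ℕ → ℕ → Pt → Set
TopLeftPath m h s = HamPath (Rect 1 m 1 h) s (1 , h) ⊎ HamPath (Rect 1 m 1 h) s (2 , h)

TopRightPath : ℕ → ℕ → Pt → Set
TopRightPath m h s = HamPath (Rect 1 m 1 h) s (m , h) ⊎ HamPath (Rect 1 m 1 h) s (m ∸ 1 , h)

TopLeftPaths : ℕ → ℕ → Set
TopLeftPaths m h = ∀ s → Rect 1 m 1 h s → TopLeftPath m h s

topRightPath : ∀ {m h} → TopLeftPaths m h → ∀ s → Rect 1 m 1 h s → TopRightPath m h s
topRightPath {m} {h} paths s@(x , y) ((1≤x , x≤m) , y∈) =
  Sum.map mirror mirror (paths (reflectˣ m s) (reflectˣ-∈ m x 1≤x x≤m , y∈))
  where
  mirror : ∀ {e} → HamPath (Rect 1 m 1 h) (reflectˣ m s) e → HamPath (Rect 1 m 1 h) s (reflectˣ m e)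
  mirror = subst (λ p → HamPath _ p _) (reflectˣ-involutive m s (m≤n⇒m≤1+n x≤m)) ∘ HamPath-reflectˣ m

columnOneTopRight : ∀ {m h} → 2 ≤ m → (2 ≤ h → TopLeftPaths m h) →
                    ∀ y → 1 ≤ y → y ≤ h → TopRightPath m h (1 , y)
columnOneTopRight {h = 1}           2≤m _     1             _   _   = inj₁ (row 1 (≤-trans (n≤1+n 1) 2≤m))
columnOneTopRight {h = 1}           _   _     (suc (suc _)) _   (s≤s ())
columnOneTopRight {h = suc (suc _)} 2≤m paths y             1≤y y≤h =
  topRightPath (paths (s≤s (s≤s z≤n))) (1 , y) ((≤-refl , ≤-trans (n≤1+n 1) 2≤m) , (1≤y , y≤h))

extendByTopRow : ∀ {m h s} → 2 ≤ m → TopRightPath m h s → HamPath (Rect 1 m 1 (suc h)) s (1 , suc h)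
extendByTopRow {suc m} {h} 2≤m = either (underTopRow (adj↑ stay)) (underTopRow (adj↑ inc))
  where
  underTopRow : ∀ {s e} → Adj (e , h) (suc m , suc h) → HamPath (Rect 1 (suc m) 1 h) s (e , h) →
                HamPath (Rect 1 (suc m) 1 (suc h)) s (1 , suc h)
  underTopRow e~ P = glueʸ (s≤s z≤n) (n≤1+n h) P (HamPath-reverse (row (suc h) (s≤s z≤n))) e~

-- (1, h+1), then the rows below from (1, h), then the top row back from (m, h+1) to (2, h+1).
fromTopLeftCorner : ∀ {m h} → 2 ≤ m → TopRightPath m h (1 , h) →
                    HamPath (Rect 1 m 1 (suc h)) (1 , suc h) (2 , suc h)
fromTopLeftCorner {suc m} {h} (s≤s 1≤m) lower = HamPath-resp-≐ (split , join)
  (HamPath-append (point 1 (suc h)) (either (rest (adj↑ stay)) (rest (adj↑ inc)) lower)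
    (Adj-sym (adj↑ stay)) corner⊥rest)
  where
  Corner Below RowTail : VSet
  Corner  = Rect 1 1 (suc h) (suc h)
  Below   = Rect 1 (suc m) 1 h
  RowTail = Rect 2 (suc m) (suc h) (suc h)
  rest : ∀ {e} → Adj (e , h) (suc m , suc h) → HamPath Below (1 , h) (e , h) →
         HamPath (Below ∪ RowTail) (1 , h) (2 , suc h)
  rest e~ P = HamPath-append P (HamPath-reverse (row (suc h) (s≤s 1≤m))) e~
    (λ ((_ , (_ , y≤h)) , (_ , (h<y , _))) → <⇒≱ h<y y≤h)
  corner⊥rest : Corner ⊥ (Below ∪ RowTail)
  corner⊥rest ((_ , (h<y , _)) , inj₁ (_ , (_ , y≤h))) = <⇒≱ h<y y≤h
  corner⊥rest (((_ , x≤1) , _) , inj₂ ((1<x , _) , _)) = <⇒≱ 1<x x≤1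
  split : Corner ∪ (Below ∪ RowTail) ⊆ Rect 1 (suc m) 1 (suc h)
  split (inj₁ ((1≤x , x≤1) , (h<y , y≤))) = (1≤x , ≤-trans x≤1 (s≤s z≤n)) , (≤-trans (s≤s z≤n) h<y , y≤)
  split (inj₂ (inj₁ (x∈ , (1≤y , y≤h)))) = x∈ , (1≤y , m≤n⇒m≤1+n y≤h)
  split (inj₂ (inj₂ ((1<x , x≤) , (h<y , y≤)))) = (≤-trans (s≤s z≤n) 1<x , x≤) , (≤-trans (s≤s z≤n) h<y , y≤)
  join : Rect 1 (suc m) 1 (suc h) ⊆ Corner ∪ (Below ∪ RowTail)
  join {p} (x∈@(1≤x , x≤) , (1≤y , y≤)) with p ʸ ≤? h | p ˣ ≤? 1
  ... | yes y≤h | _       = inj₂ (inj₁ (x∈ , (1≤y , y≤h)))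
  ... | no  y≰h | yes x≤1 = inj₁ ((1≤x , x≤1) , (≰⇒> y≰h , y≤))
  ... | no  y≰h | no  x≰1 = inj₂ (inj₂ ((≰⇒> x≰1 , x≤) , (≰⇒> y≰h , y≤)))

viaColumnOne : ∀ {m h} → 1 ≤ h → TopLeftPaths h m →
               ∀ s → Rect 2 (suc m) 1 h s → HamPath (Rect 1 (suc m) 1 h) s (1 , h)
viaColumnOne {m} {h} 1≤h paths s@(x , y) ((2≤x , x≤1+m) , y∈) =
  either (afterColumnOne stay) (afterColumnOne inc) (paths s′ (y∈ , reflectˣ-∈ m (x ∸ 1) 1≤x∸1 x∸1≤m))
  where
  1≤x∸1 : 1 ≤ x ∸ 1
  1≤x∸1 = ∸-monoˡ-≤ 1 2≤x
  x∸1≤m : x ∸ 1 ≤ m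
  x∸1≤m = ∸-monoˡ-≤ 1 x≤1+m
  s′ : Pt
  s′ = y , suc m ∸ (x ∸ 1)
  -- transposing and reflecting carries R(h, m) onto the columns 2 … m + 1 of R(m + 1, h)
  embed : Pt → Pt
  embed = shiftˣ 1 ∘ reflectˣ m ∘ transpose
  embed-s′ : embed s′ ≡ s
  embed-s′ = cong (_, y) (trans (cong suc (m∸[m∸n]≡n (m≤n⇒m≤1+n x∸1≤m))) (m+[n∸m]≡n (≤-trans (s≤s z≤n) 2≤x)))
  embed-corner : ∀ e → embed (e , m) ≡ (2 , e)
  embed-corner e = cong (λ z → suc z , e) (m+n∸n≡m 1 m)
  afterColumnOne : ∀ {e} → Near 1 e → HamPath (Rect 1 h 1 m) s′ (e , m) → HamPath (Rect 1 (suc m) 1 h) s (1 , h)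
  afterColumnOne 1~e P = HamPath-reverse (glueˣ (s≤s z≤n) (s≤s z≤n)
    (HamPath-reverse (column 1 1≤h))
    (HamPath-reverse (subst₂ (HamPath _) embed-s′ (embed-corner _)
      (HamPath-shiftˣ 1 (HamPath-reflectˣ m (HamPath-transpose P)))))
    (adj→ 1~e))

fromColumnOne : ∀ {m h} → 2 ≤ m → 1 ≤ h → (2 ≤ h → TopLeftPaths m h) →
                ∀ y → 1 ≤ y → y ≤ suc h → TopLeftPath m (suc h) (1 , y)
fromColumnOne {h = h} 2≤m 1≤h paths y 1≤y y≤1+h with y ≤? h
... | yes y≤h = inj₁ (extendByTopRow 2≤m (columnOneTopRight 2≤m paths y 1≤y y≤h))
... | no  y≰h with refl ← ≤-antisym y≤1+h (≰⇒> y≰h) =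
  inj₂ (fromTopLeftCorner 2≤m (columnOneTopRight 2≤m paths h 1≤h ≤-refl))

-- s in column 1: split off the top row; s elsewhere: split off column 1, leaving a transposed smaller
-- instance, except for m = 2, which is the mirror image of column 1.
topLeftPathsStep : ∀ {m h} → 2 ≤ suc m → 2 ≤ suc h →
                   (2 ≤ h → TopLeftPaths (suc m) h) → (2 ≤ m → TopLeftPaths (suc h) m) →
                   TopLeftPaths (suc m) (suc h)
topLeftPathsStep {m} 2≤1+m 2≤1+h shorter narrower (x , y) ((1≤x , x≤1+m) , y∈@(1≤y , y≤1+h))
  with x ≤? 1 | 2 ≤? m
... | yes x≤1 | _ with refl ← ≤-antisym x≤1 1≤x = fromColumnOne 2≤1+m (s≤s⁻¹ 2≤1+h) shorter y 1≤y y≤1+h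
... | no  x≰1 | yes 2≤m = inj₁ (viaColumnOne (s≤s z≤n) (narrower 2≤m) (x , y) ((≰⇒> x≰1 , x≤1+m) , y∈))
... | no  x≰1 | no  2≰m
  with refl ← ≤-antisym (s≤s⁻¹ (≰⇒> 2≰m)) (s≤s⁻¹ 2≤1+m)
  with refl ← ≤-antisym x≤1+m (≰⇒> x≰1) =
  Sum.swap (Sum.map (HamPath-reflectˣ 2) (HamPath-reflectˣ 2) (fromColumnOne 2≤1+m (s≤s⁻¹ 2≤1+h) shorter y 1≤y y≤1+h))

topLeftPaths′ : ∀ size {m h} → m + h ≤ size → 2 ≤ m → 2 ≤ h → TopLeftPaths m h
topLeftPaths′ (suc size) {suc m} {suc h} (s≤s m+1+h≤size) 2≤1+m 2≤1+h = topLeftPathsStep 2≤1+m 2≤1+h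
  (topLeftPaths′ size (subst (_≤ size) (+-suc m h) m+1+h≤size) 2≤1+m)
  (topLeftPaths′ size (subst (_≤ size) (+-comm m (suc h)) m+1+h≤size) 2≤1+h)

topLeftPaths : ∀ {m h} → 2 ≤ m → 2 ≤ h → TopLeftPaths m h
topLeftPaths {m} {h} = topLeftPaths′ (m + h) ≤-refl

bottomPath : ∀ {m c s} → 2 ≤ m → 1 ≤ c → Rect 1 m 1 c s → (c ≡ 1 → 3 ≤ m → s ˣ ≡ m) → TopLeftPath m c s
bottomPath {c = suc (suc _)} 2≤m _ s∈ _ = topLeftPaths 2≤m (s≤s (s≤s z≤n)) _ s∈
bottomPath {m} {c = 1} {x , y} 2≤m _ ((1≤x , x≤m) , (1≤y , y≤1)) endpoint
  with refl ← ≤-antisym y≤1 1≤y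
  with x ≟ m | 3 ≤? m
... | yes refl | _       = inj₁ (HamPath-reverse (row 1 1≤x))
... | no  x≢m  | yes 3≤m = ⊥-elim (x≢m (endpoint refl 3≤m))
... | no  x≢m  | no  3≰m
  with refl ← ≤-antisym (s≤s⁻¹ (≰⇒> 3≰m)) 2≤m
  with refl ← ≤-antisym (s≤s⁻¹ (≤∧≢⇒< x≤m x≢m)) 1≤x = inj₂ (row 1 (s≤s z≤n))

-- The mirror image of bottomPath under y ↦ K + d + 1 − y.
topPath : ∀ {m K d t} → 2 ≤ m → 1 ≤ d → Rect 1 m (suc K) (K + d) t → (d ≡ 1 → 3 ≤ m → t ˣ ≡ m) →
          HamPath (Rect 1 m (suc K) (K + d)) (1 , suc K) t ⊎ HamPath (Rect 1 m (suc K) (K + d)) (2 , suc K) t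
topPath {m} {K} {d} {x , y} 2≤m 1≤d (x∈ , (K<y , y≤K+d)) endpoint =
  Sum.map fromBottom fromBottom (bottomPath 2≤m 1≤d (x∈ , reflectˣ-∈ d (y ∸ K) 1≤y∸K y∸K≤d) endpoint)
  where
  1≤y∸K : 1 ≤ y ∸ K
  1≤y∸K = subst (_≤ y ∸ K) (m+n∸n≡m 1 K) (∸-monoˡ-≤ K K<y)
  y∸K≤d : y ∸ K ≤ d
  y∸K≤d = subst (y ∸ K ≤_) (m+n∸m≡n K d) (∸-monoˡ-≤ K y≤K+d)
  y-back : K + (suc d ∸ (suc d ∸ (y ∸ K))) ≡ y
  y-back = trans (cong (K +_) (m∸[m∸n]≡n (m≤n⇒m≤1+n y∸K≤d))) (m+[n∸m]≡n (≤-trans (n≤1+n K) K<y))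
  bottom-back : K + (suc d ∸ d) ≡ suc K
  bottom-back = trans (cong (K +_) (m+n∸n≡m 1 d)) (+-comm K 1)
  reflectʸ : Pt → Pt
  reflectʸ = transpose ∘ shiftˣ K ∘ reflectˣ d ∘ transpose
  fromBottom : ∀ {e} → HamPath (Rect 1 m 1 d) (x , suc d ∸ (y ∸ K)) (e , d) →
          HamPath (Rect 1 m (suc K) (K + d)) (e , suc K) (x , y)
  fromBottom {e} P = HamPath-reverse (subst₂ (HamPath _) (cong (x ,_) y-back) (cong (e ,_) bottom-back)
    (subst (λ a → HamPath (Rect 1 m a (K + d)) (reflectʸ (x , suc d ∸ (y ∸ K))) (reflectʸ (e , d))) (+-comm K 1)
      (HamPath-transpose (HamPath-shiftˣ K (HamPath-reflectˣ d (HamPath-transpose P))))))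

Walk-source : ∀ {W u v} → Walk W u v → W u
Walk-source (here Wu)     = Wu
Walk-source (step Wu _ _) = Wu

Walk-preserves : ∀ {W : VSet} (I : Pt → Set) → (∀ {p q} → W p → W q → Adj p q → I p → I q) →
                 ∀ {u v} → Walk W u v → I u → I v
Walk-preserves I keep (here _)            Iu = Iu
Walk-preserves I keep (step Wu u~v walk) Iu = Walk-preserves I keep walk (keep Wu (Walk-source walk) u~v Iu)

∣m-n∣≤1⇒m≤1+n×n≤1+m : ∀ m n → ∣ m - n ∣ ≤ 1 → m ≤ suc n × n ≤ suc m
∣m-n∣≤1⇒m≤1+n×n≤1+m zero    n       d≤1 = z≤n , d≤1
∣m-n∣≤1⇒m≤1+n×n≤1+m (suc m) zero    d≤1 = d≤1 , z≤n
∣m-n∣≤1⇒m≤1+n×n≤1+m (suc m) (suc n) d≤1 =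
  let m≤1+n , n≤1+m = ∣m-n∣≤1⇒m≤1+n×n≤1+m m n d≤1 in s≤s m≤1+n , s≤s n≤1+m

RowSealed : VSet → ℕ → Set
RowSealed V y₀ = ∀ q → V q → 2 ≤ q ˣ → ∣ q ʸ - y₀ ∣ ≤ 1 → q ʸ ≡ y₀

module _ {V : VSet} {m y₀ : ℕ} (sealed : RowSealed V y₀) where

  interiorCut : ∀ {x} → 2 ≤ x → x < m → V (m , y₀) → V (1 , y₀) → Disconnected (Minus V (_≡ (x , y₀)))
  interiorCut {x} 2≤x x<m Vm V1 =
    (m , y₀) , (1 , y₀) , (Vm , λ e → <-irrefl (sym (cong proj₁ e)) x<m) , (V1 , λ e → <⇒≱ 2≤x (≤-reflexive (sym (cong proj₁ e)))) ,
    λ walk → <⇒≱ (≤-trans (s≤s z≤n) 2≤x) (s≤s⁻¹ (proj₁ (Walk-preserves RightOfX keep walk (x<m , refl))))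
    where
    RightOfX : Pt → Set
    RightOfX p = x < p ˣ × p ʸ ≡ y₀
    keep : ∀ {p q} → Minus V (_≡ (x , y₀)) p → Minus V (_≡ (x , y₀)) q → Adj p q → RightOfX p → RightOfX q
    keep {px , .y₀} {qx , qy} _ (Vq , q≢) (_ , dx , dy) (x<px , refl) = ≤∧≢⇒< x≤qx (λ x≡qx → q≢ (cong₂ _,_ (sym x≡qx) qy≡y₀)) , qy≡y₀
      where
      x≤qx : x ≤ qx
      x≤qx = s≤s⁻¹ (≤-trans x<px (proj₁ (∣m-n∣≤1⇒m≤1+n×n≤1+m px qx dx)))
      qy≡y₀ : qy ≡ y₀
      qy≡y₀ = sealed (qx , qy) Vq (≤-trans 2≤x x≤qx) (subst (_≤ 1) (∣-∣-comm y₀ qy) dy)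

  endDeg1 : (∀ q → V q → q ˣ ≤ m) → 3 ≤ m → V (m ∸ 1 , y₀) → Deg1 V (m , y₀)
  endDeg1 x≤m (s≤s 2≤m′) Vm′ = _ , Vm′ , Adj-sym (adj→ stay) , onlyNeighbour
    where
    onlyNeighbour : ∀ v → V v → Adj (m , y₀) v → v ≡ (m ∸ 1 , y₀)
    onlyNeighbour (vx , vy) Vv (m≢v , dx , dy) = cong₂ _,_ vx≡m∸1 vy≡y₀
      where
      m≤1+vx : m ≤ suc vx
      m≤1+vx = proj₁ (∣m-n∣≤1⇒m≤1+n×n≤1+m m vx dx)
      vy≡y₀ : vy ≡ y₀
      vy≡y₀ = sealed (vx , vy) Vv (≤-trans 2≤m′ (s≤s⁻¹ m≤1+vx)) (subst (_≤ 1) (∣-∣-comm y₀ vy) dy)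
      vx≡m∸1 : vx ≡ m ∸ 1
      vx≡m∸1 = ≤-antisym (s≤s⁻¹ (≤∧≢⇒< (x≤m (vx , vy) Vv) (λ vx≡m → m≢v (sym (cong₂ _,_ vx≡m vy≡y₀)))))
                         (s≤s⁻¹ m≤1+vx)

  sealedRowEndpoint : (∀ q → V q → q ˣ ≤ m) → 3 ≤ m → V (m , y₀) × V (1 , y₀) × V (m ∸ 1 , y₀) →
                      ∀ {x} → 1 ≤ x → x ≤ m → ¬ Disconnected (Minus V (_≡ (x , y₀))) →
                      (x ≡ 1 → ¬ Deg1 V (m , y₀)) → x ≡ m
  sealedRowEndpoint x≤m 3≤m (Vm , V1 , Vm∸1) {x} 1≤x x≤m′ notCut notDeg1 with x ≟ m | x ≤? 1
  ... | yes x≡m | _       = x≡m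
  ... | no  x≢m | yes x≤1 = ⊥-elim (notDeg1 (≤-antisym x≤1 1≤x) (endDeg1 x≤m 3≤m Vm∸1))
  ... | no  x≢m | no  x≰1 = ⊥-elim (notCut (interiorCut (≰⇒> x≰1) (≤∧≢⇒< x≤m′ x≢m) Vm V1))

F3-sym : ∀ {V s t} → F3 V s t → F3 V t s
F3-sym (w , Vw , w≢s , w≢t , deg) = w , Vw , w≢t , w≢s , deg

module CShape (m n k l c : ℕ) (a≡1 : m ∸ k ≡ 1) (2≤m : 2 ≤ m) (1≤l : 1 ≤ l) (1≤c : 1 ≤ c)
              (1≤d : 1 ≤ n ∸ l ∸ c) where

  K : ℕ
  K = c + l

  d : ℕ
  d = n ∸ l ∸ c

  V : VSet
  V = InC m n k l c

  K+d≡n : K + d ≡ n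
  K+d≡n = begin
    c + l + (n ∸ l ∸ c)   ≡⟨ cong₂ _+_ (+-comm c l) (∸-+-assoc n l c) ⟩
    l + c + (n ∸ (l + c)) ≡⟨ m+[n∸m]≡n {l + c} (<⇒≤ (m∸n≢0⇒n<m (m<n⇒n≢0 (subst (1 ≤_) (∸-+-assoc n l c) 1≤d)))) ⟩
    n                     ∎
    where open ≡-Reasoning

  1≤m : 1 ≤ m
  1≤m = ≤-trans (n≤1+n 1) 2≤m

  c<K : c < K
  c<K = subst (_≤ K) (+-comm c 1) (+-monoʳ-≤ c 1≤l)

  K<n : K < n
  K<n = subst (K <_) K+d≡n (subst (_≤ K + d) (+-comm K 1) (+-monoʳ-≤ K 1≤d))

  1≤n : 1 ≤ n
  1≤n = ≤-trans (s≤s z≤n) K<n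

  data Band (y : ℕ) : Set where
    below  : y ≤ c → Band y
    beside : c < y → y ≤ K → Band y
    above  : K < y → Band y

  band : ∀ y → Band y
  band y with y ≤? c | y ≤? K
  ... | yes y≤c | _       = below y≤c
  ... | no  y≰c | yes y≤K = beside (≰⇒> y≰c) y≤K
  ... | no  _   | no  y≰K = above (≰⇒> y≰K)

  ∈V : ∀ {x y} → 1 ≤ x → x ≤ m → 1 ≤ y → y ≤ n → y ≤ c ⊎ K < y → V (x , y)
  ∈V 1≤x x≤m 1≤y y≤n y∉notch = ((1≤x , x≤m) , (1≤y , y≤n)) ,
    λ (_ , (c<y , y≤K)) → either (<⇒≱ c<y) (λ K<y → <⇒≱ K<y y≤K) y∉notch

  notch-empty : ∀ {q} → V q → 2 ≤ q ˣ → c < q ʸ → ¬ q ʸ ≤ K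
  notch-empty {q} (((_ , x≤m) , _) , ∉notch) 2≤x c<y y≤K =
    ∉notch ((subst (λ a → suc a ≤ q ˣ) (sym a≡1) 2≤x , x≤m) , (c<y , y≤K))

  Bottom Bridge Top : VSet
  Bottom = Rect 1 m 1 c
  Bridge = Rect 1 1 (suc c) K
  Top    = Rect 1 m (suc K) (K + d)

  decomposition : Bottom ∪ (Bridge ∪ Top) ≐ V
  decomposition = split , join
    where
    split : Bottom ∪ (Bridge ∪ Top) ⊆ V
    split (inj₁ ((1≤x , x≤m) , (1≤y , y≤c))) =
      ∈V 1≤x x≤m 1≤y (≤-trans y≤c (<⇒≤ (<-trans c<K K<n))) (inj₁ y≤c)
    split {x , _} (inj₂ (inj₁ ((1≤x , x≤1) , (c<y , y≤K)))) =
      ((1≤x , ≤-trans x≤1 1≤m) , (≤-trans (s≤s z≤n) c<y , ≤-trans y≤K (<⇒≤ K<n))) ,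
      λ ((1+a≤x , _) , _) → <⇒≱ (subst (λ a → suc a ≤ x) a≡1 1+a≤x) x≤1
    split (inj₂ (inj₂ ((1≤x , x≤m) , (K<y , y≤K+d)))) =
      ∈V 1≤x x≤m (≤-trans (s≤s z≤n) K<y) (subst (_ ≤_) K+d≡n y≤K+d) (inj₂ K<y)
    join : V ⊆ Bottom ∪ (Bridge ∪ Top)
    join {x , y} Vp@((x∈@(1≤x , _) , (1≤y , y≤n)) , _) with band y | x ≤? 1
    ... | below  y≤c     | _       = inj₁ (x∈ , (1≤y , y≤c))
    ... | beside c<y y≤K | yes x≤1 = inj₂ (inj₁ ((1≤x , x≤1) , (c<y , y≤K)))
    ... | beside c<y y≤K | no  x≰1 = ⊥-elim (notch-empty Vp (≰⇒> x≰1) c<y y≤K)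
    ... | above  K<y     | _       = inj₂ (inj₂ (x∈ , (K<y , subst (y ≤_) (sym K+d≡n) y≤n)))

  viaBridge : ∀ {s t e₁ e₂} → Near e₁ 1 → Near 1 e₂ → HamPath Bottom s (e₁ , c) → HamPath Top (e₂ , suc K) t →
            HamPath V s t
  viaBridge e₁~1 1~e₂ P Q = HamPath-resp-≐ decomposition
    (HamPath-append P (HamPath-append (column 1 c<K) Q (adj↑ 1~e₂) Bridge⊥Top) (adj↑ e₁~1) Bottom⊥rest)
    where
    Bridge⊥Top : Bridge ⊥ Top
    Bridge⊥Top ((_ , (_ , y≤K)) , (_ , (K<y , _))) = <⇒≱ K<y y≤K
    Bottom⊥rest : Bottom ⊥ (Bridge ∪ Top)
    Bottom⊥rest ((_ , (_ , y≤c)) , inj₁ (_ , (c<y , _))) = <⇒≱ c<y y≤c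
    Bottom⊥rest ((_ , (_ , y≤c)) , inj₂ (_ , (K<y , _))) = <⇒≱ (<-trans c<K K<y) y≤c

  bottomToTop : ∀ {s t} → Bottom s → Top t → (c ≡ 1 → 3 ≤ m → s ˣ ≡ m) → (d ≡ 1 → 3 ≤ m → t ˣ ≡ m) →
            HamPath V s t
  bottomToTop s∈ t∈ s-end t-end with bottomPath 2≤m 1≤c s∈ s-end | topPath 2≤m 1≤d t∈ t-end
  ... | inj₁ P | inj₁ Q = viaBridge stay stay P Q
  ... | inj₁ P | inj₂ Q = viaBridge stay inc  P Q
  ... | inj₂ P | inj₁ Q = viaBridge dec  stay P Q
  ... | inj₂ P | inj₂ Q = viaBridge dec  inc  P Q

  V-x≤m : ∀ q → V q → q ˣ ≤ m
  V-x≤m _ (((_ , x≤m) , _) , _) = x≤m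

  rowEnds : ∀ {y} → 1 ≤ y → y ≤ n → y ≤ c ⊎ K < y → V (m , y) × V (1 , y) × V (m ∸ 1 , y)
  rowEnds 1≤y y≤n y∉notch =
    ∈V 1≤m ≤-refl 1≤y y≤n y∉notch , ∈V ≤-refl 1≤m 1≤y y≤n y∉notch ,
    ∈V (∸-monoˡ-≤ 1 2≤m) (m∸n≤m m 1) 1≤y y≤n y∉notch

  bridge-x≡1 : ∀ {q} → V q → c < q ʸ → q ʸ ≤ K → q ˣ ≡ 1
  bridge-x≡1 {x , _} Vq@(((1≤x , _) , _) , _) c<y y≤K with x ≤? 1
  ... | yes x≤1 = ≤-antisym x≤1 1≤x
  ... | no  x≰1 = ⊥-elim (notch-empty Vq (≰⇒> x≰1) c<y y≤K)

  bridgeCut : ∀ {s} → V s → c < s ʸ → s ʸ ≤ K → Disconnected (Minus V (_≡ s))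
  bridgeCut {sx , sy} Vs c<sy sy≤K =
    (1 , 1) , (1 , n) ,
    (∈V ≤-refl 1≤m ≤-refl 1≤n (inj₁ 1≤c) , <⇒≢ 1<sy ∘ cong proj₂) ,
    (∈V ≤-refl 1≤m 1≤n ≤-refl (inj₂ K<n) , <⇒≢ sy<n ∘ sym ∘ cong proj₂) ,
    λ walk → <-asym sy<n (Walk-preserves (λ p → p ʸ < sy) keep walk 1<sy)
    where
    1<sy : 1 < sy
    1<sy = ≤-trans (s≤s 1≤c) c<sy
    sy<n : sy < n
    sy<n = ≤-<-trans sy≤K K<n
    keep : ∀ {p q} → Minus V (_≡ (sx , sy)) p → Minus V (_≡ (sx , sy)) q → Adj p q → p ʸ < sy → q ʸ < sy
    keep {_ , py} {_ , qy} _ (Vq , q≢s) (_ , _ , dy) py<sy with qy ≟ sy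
    ... | no  qy≢sy = ≤∧≢⇒< (≤-trans (proj₂ (∣m-n∣≤1⇒m≤1+n×n≤1+m py qy dy)) py<sy) qy≢sy
    ... | yes refl  = ⊥-elim (q≢s (cong₂ _,_ (trans (bridge-x≡1 Vq c<sy sy≤K) (sym (bridge-x≡1 Vs c<sy sy≤K))) refl))

  bottomRowSealed : c ≡ 1 → RowSealed V 1
  bottomRowSealed refl (qx , qy) Vq 2≤qx dy with band qy
  ... | below  qy≤1      = ≤-antisym qy≤1 (proj₁ (proj₂ (proj₁ Vq)))
  ... | beside 1<qy qy≤K = ⊥-elim (notch-empty Vq 2≤qx 1<qy qy≤K)
  ... | above  K<qy      = ⊥-elim (<⇒≱ K<qy (≤-trans (proj₁ (∣m-n∣≤1⇒m≤1+n×n≤1+m qy 1 dy)) (s≤s 1≤l)))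

  d≡1⇒n≡1+K : d ≡ 1 → n ≡ suc K
  d≡1⇒n≡1+K d≡1 = trans (sym K+d≡n) (trans (cong (K +_) d≡1) (+-comm K 1))

  topRowSealed : d ≡ 1 → RowSealed V n
  topRowSealed d≡1 (qx , qy) Vq 2≤qx dy
    with band qy | s≤s⁻¹ (subst (_≤ suc qy) (d≡1⇒n≡1+K d≡1) (proj₂ (∣m-n∣≤1⇒m≤1+n×n≤1+m qy n dy)))
  ... | below  qy≤c      | K≤qy = ⊥-elim (<⇒≱ c<K (≤-trans K≤qy qy≤c))
  ... | beside c<qy qy≤K | _    = ⊥-elim (notch-empty Vq 2≤qx c<qy qy≤K)
  ... | above  K<qy      | _    = ≤-antisym (proj₂ (proj₂ (proj₁ Vq))) (subst (_≤ qy) (sym (d≡1⇒n≡1+K d≡1)) K<qy)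

  farCorner≢ : ∀ {x y y′ : ℕ} → 3 ≤ m → x ≡ 1 → ¬ (m , y) ≡ (x , y′)
  farCorner≢ (s≤s (s≤s _)) refl ()

  bottomEndpoint : ∀ {s} → V s → s ʸ ≤ c → ¬ Disconnected (Minus V (_≡ s)) →
                   (¬ (m , 1) ≡ s → ¬ Deg1 V (m , 1)) → c ≡ 1 → 3 ≤ m → s ˣ ≡ m
  bottomEndpoint {x , y} (((1≤x , x≤m) , (1≤y , _)) , _) y≤c notCut notDeg1 c≡1 3≤m
    with refl ← ≤-antisym (subst (y ≤_) c≡1 y≤c) 1≤y =
    sealedRowEndpoint (bottomRowSealed c≡1) V-x≤m 3≤m (rowEnds ≤-refl 1≤n (inj₁ 1≤c)) 1≤x x≤m notCut
      (notDeg1 ∘ farCorner≢ 3≤m)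

  topEndpoint : ∀ {t} → V t → K < t ʸ → ¬ Disconnected (Minus V (_≡ t)) →
                (¬ (m , n) ≡ t → ¬ Deg1 V (m , n)) → d ≡ 1 → 3 ≤ m → t ˣ ≡ m
  topEndpoint {x , y} (((1≤x , x≤m) , (_ , y≤n)) , _) K<y notCut notDeg1 d≡1 3≤m
    with refl ← ≤-antisym y≤n (subst (_≤ y) (sym (d≡1⇒n≡1+K d≡1)) K<y) =
    sealedRowEndpoint (topRowSealed d≡1) V-x≤m 3≤m (rowEnds 1≤n ≤-refl (inj₂ K<n)) 1≤x x≤m notCut
      (notDeg1 ∘ farCorner≢ 3≤m)

  hamiltonianAcross : ∀ {s t} → V s → V t → s ʸ ≤ c → K < t ʸ →
                      ¬ Disconnected (Minus V (_≡ s)) → ¬ Disconnected (Minus V (_≡ t)) → ¬ F3 V s t →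
                      HamPath V s t
  hamiltonianAcross {s} {t} Vs@((s-x∈ , (1≤sy , _)) , _) Vt@((t-x∈ , (_ , ty≤n)) , _) sy≤c K<ty
                    s-notCut t-notCut ¬F3 =
    bottomToTop (s-x∈ , (1≤sy , sy≤c)) (t-x∈ , (K<ty , subst (t ʸ ≤_) (sym K+d≡n) ty≤n))
      (bottomEndpoint Vs sy≤c s-notCut λ m1≢s deg → ¬F3 ((m , 1) , V-m1 , m1≢s , m1≢t , deg))
      (topEndpoint Vt K<ty t-notCut λ mn≢t deg → ¬F3 ((m , n) , V-mn , mn≢s , mn≢t , deg))
    where
    V-m1 : V (m , 1)
    V-m1 = proj₁ (rowEnds ≤-refl 1≤n (inj₁ 1≤c))
    V-mn : V (m , n)
    V-mn = proj₁ (rowEnds 1≤n ≤-refl (inj₂ K<n))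
    m1≢t : ¬ (m , 1) ≡ t
    m1≢t = <⇒≢ (≤-<-trans (≤-trans 1≤c (<⇒≤ c<K)) K<ty) ∘ cong proj₂
    mn≢s : ¬ (m , n) ≡ s
    mn≢s = <⇒≢ (≤-<-trans sy≤c (<-trans c<K K<n)) ∘ sym ∘ cong proj₂

  hamiltonian : ∀ {s t} → V s → V t → ¬ F1 V s t → ¬ F3 V s t → ¬ F9 m k l c s t → HamPath V s t
  hamiltonian {s} {t} Vs Vt ¬F1 ¬F3 ¬F9 with band (s ʸ) | band (t ʸ)
  ... | beside c<sy sy≤K | _                = ⊥-elim (¬F1 (inj₁ (bridgeCut Vs c<sy sy≤K)))
  ... | _                | beside c<ty ty≤K = ⊥-elim (¬F1 (inj₂ (inj₁ (bridgeCut Vt c<ty ty≤K))))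
  ... | below sy≤c       | below ty≤c       = ⊥-elim (¬F9 (a≡1 , inj₁ (sy≤c , ty≤c)))
  ... | above K<sy       | above K<ty       = ⊥-elim (¬F9 (a≡1 , inj₂ (K<sy , K<ty)))
  ... | below sy≤c       | above K<ty       = hamiltonianAcross Vs Vt sy≤c K<ty (¬F1 ∘ inj₁) (¬F1 ∘ inj₂ ∘ inj₁) ¬F3
  ... | above K<sy       | below ty≤c       =
    HamPath-reverse (hamiltonianAcross Vt Vs ty≤c K<sy (¬F1 ∘ inj₂ ∘ inj₁) (¬F1 ∘ inj₁) (¬F3 ∘ F3-sym))

lemma8 : (m n k l c : ℕ) → m ∸ k ≡ 1 → 2 ≤ m → 3 ≤ n
       → 1 ≤ k → 1 ≤ l → 1 ≤ c → 1 ≤ n ∸ l ∸ c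
       → (s t : Pt) → InC m n k l c s → InC m n k l c t → ¬ (s ≡ t)
       → ¬ F1 (InC m n k l c) s t → ¬ F3 (InC m n k l c) s t → ¬ F9 m k l c s t
       → HamPath (InC m n k l c) s t
lemma8 m n k l c a≡1 2≤m _ _ 1≤l 1≤c 1≤d _ _ Vs Vt _ =
  CShape.hamiltonian m n k l c a≡1 2≤m 1≤l 1≤c 1≤d Vs Vt
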